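{- Let $\mathbf{c}\in\mathbb{F}_{q^2}^4$ with $\mathbf{c}\ne0$. If $f_{\mathbf{c}}$ is planar on $\mathbb{F}_{q^2}$, then $g_{\mathbf{c}}$ is non-constant and $A_{\mathbf{c}}(X)$ has no roots in $\mu_{q+1}$.
   Context: Let $p$ be an odd prime, $k,\ell$ positive integers, $q=p^k$, $Q=p^\ell$; for $c\in\mathbb{F}_{q^2}$ write $\bar c=c^q$; $\mu_{q+1}$ is the set of $(q+1)$-th roots of unity in $\overline{\mathbb{F}}_q$. For $\mathbf{c}=(c_0,c_1,c_2,c_3)\in\mathbb{F}_{q^2}^4\setminus\{0\}$ define $f_{\mathbf{c}}(X)=c_0X^{qQ+q}+c_1X^{qQ+1}+c_2X^{Q+q}+c_3X^{Q+1}$, $A_{\mathbf{c}}(X)=c_0X^{Q+1}+c_1X^Q+c_2X+c_3$, $B_{\mathbf{c}}(X)=\bar c_3X^{Q+1}+\bar c_2X^Q+\bar c_1X+\bar c_0$, and $g_{\mathbf{c}}=B_{\mathbf{c}}/A_{\mathbf{c}}$. A function $F:\mathbb{F}_{q^2}\to\mathbb{F}_{q^2}$ is planar if for every $a\in\mathbb{F}_{q^2}^*$ the map $x\mapsto F(x+a)-F(x)$ is a bijection of $\mathbb{F}_{q^2}$. -}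

module Defs where

open import Level using (0ℓ)
open import Data.Nat as ℕ using (ℕ; zero; suc)
open import Data.Fin using (Fin)
open import Data.Product using (Σ; _×_; ∃)
open import Relation.Nullary using (¬_)
open import Relation.Binary.PropositionalEquality using (_≡_)
open import Algebra.Structures using (IsCommutativeRing)
open import Function.Definitions using (Bijective)
open import Function.Bundles using (_⤖_)

record Field : Set₁ where
  infixl 6 _+_ _-_
  infixl 7 _*_
  field
    Carrier : Set
    _+_ _*_ : Carrier → Carrier → Carrier
    -_      : Carrier → Carrier
    0# 1#   : Carrier
    isCommutativeRing : IsCommutativeRing _≡_ _+_ _*_ -_ 0# 1#
    0≢1     : ¬ (0# ≡ 1#)
    inverse : ∀ x → ¬ (x ≡ 0#) → Σ Carrier (λ y → x * y ≡ 1#)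

  _-_ : Carrier → Carrier → Carrier
  x - y = x + (- y)

  infixr 8 _^_
  _^_ : Carrier → ℕ → Carrier
  x ^ zero  = 1#
  x ^ suc n = x * (x ^ n)

HasCard : Field → ℕ → Set
HasCard F n = Fin n ⤖ Field.Carrier F

module Setup (F : Field) (q Q : ℕ) where
  open Field F

  conj : Carrier → Carrier
  conj c = c ^ q

  record Coeffs : Set where
    constructor ⟨_,_,_,_⟩
    field c0 c1 c2 c3 : Carrier
  open Coeffs public

  NonZero : Coeffs → Set
  NonZero c = ¬ (c0 c ≡ 0# × c1 c ≡ 0# × c2 c ≡ 0# × c3 c ≡ 0#)

  f : Coeffs → Carrier → Carrier
  f c x = c0 c * x ^ (q ℕ.* Q ℕ.+ q) + c1 c * x ^ (q ℕ.* Q ℕ.+ 1)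
        + c2 c * x ^ (Q ℕ.+ q) + c3 c * x ^ (Q ℕ.+ 1)

  A : Coeffs → Carrier → Carrier
  A c x = c0 c * x ^ (Q ℕ.+ 1) + c1 c * x ^ Q + c2 c * x + c3 c

  -- Polynomials of the shape a X^{Q+1} + b X^Q + c X + d (Q ≥ 1, so these
  -- four monomials are distinct) are represented by their coefficient vector.
  -- A_c has coefficients (c0,c1,c2,c3), B_c has (c̄3,c̄2,c̄1,c̄0).
  Bcoeffs : Coeffs → Coeffs
  Bcoeffs c = ⟨ conj (c3 c) , conj (c2 c) , conj (c1 c) , conj (c0 c) ⟩

  -- The rational function g_c = B_c / A_c (with A_c ≠ 0 as c ≠ 0) is constant
  -- iff B_c = λ · A_c as polynomials for some constant λ (λ necessarily
  -- lies in F_{q^2}, as A_c has a nonzero coefficient in F_{q^2}).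
  GConstant : Coeffs → Set
  GConstant c = ∃ λ (l : Carrier) →
      c0 (Bcoeffs c) ≡ l * c0 c × c1 (Bcoeffs c) ≡ l * c1 c
    × c2 (Bcoeffs c) ≡ l * c2 c × c3 (Bcoeffs c) ≡ l * c3 c

  -- μ_{q+1} (all of it lies in F_{q^2})
  InMu : Carrier → Set
  InMu x = x ^ (q ℕ.+ 1) ≡ 1#

  Planar : (Carrier → Carrier) → Set
  Planar h = ∀ a → ¬ (a ≡ 0#) → Bijective _≡_ _≡_ (λ x → h (x + a) - h x)

{-# OPTIONS --safe #-}
module Submission where

-- Write x̄ = x^q.  A field with q² elements has characteristic p, so x ↦ x̄ is
-- additive, multiplicative and (by Fermat) an involution, and x ↦ x^{p^j} is odd.
-- With X = x^Q one has f_c(x) = c0 X̄x̄ + c1 X̄x + c2 Xx̄ + c3 Xx, so f_c is even and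
-- f_c(0) = 0; for a planar even function this forces f_c(x) ≠ 0 whenever x ≠ 0.
-- If A_c(z) = 0 with z ∈ μ_{q+1}, then f_c(x) = X x A_c(z) = 0 whenever x̄ = z x,
-- and every x = z̄ w̄ + w is of this kind; so z̄ w̄ + w = 0 for all w, impossible for
-- a nonzero polynomial of degree q < q².  If g_c is constant, B_c = λ A_c, then
-- conj (f_c(x)) = f_{B_c}(x) = λ f_c(x); as y ↦ f_c(y + 1) - f_c(y) is onto, w̄ = λ w
-- for all w, again too many roots.

open import Defs

open import Level using (0ℓ)
open import Algebra.Bundles using (CommutativeRing; CommutativeMonoid)
open import Data.Fin as Fin using (Fin; punchIn; toℕ; fromℕ; inject₁)
open import Data.Fin.Properties using (punchInᵢ≢i; suc-injective; toℕ-fromℕ; toℕ-inject₁; toℕ<n)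
open import Data.List using (List; []; _∷_; [_]; _++_; length; replicate)
open import Data.List.Properties using (length-++; length-replicate)
open import Data.List.Relation.Unary.All using (All; []; _∷_)
open import Data.List.Relation.Unary.All.Properties using (++⁻ʳ)
open import Data.Nat as ℕ using (ℕ; zero; suc; _∸_; _≤_; _<_; z≤n; s≤s)
open import Data.Nat.Combinatorics using (_C_; nCn≡1)
open import Data.Nat.Divisibility using (_∣_; divides)
open import Data.Nat.Primality using (Prime; prime⇒nonZero; prime⇒nonTrivial)
open import Data.Product using (_×_; _,_; proj₁; proj₂)
open import Data.Vec.Functional using (removeAt)
open import Function using (_∘_; _↔_; Inverse; mk↔ₛ′; _⤖_; Bijection; Injective)
open import Function.Properties.Bijection using (⤖⇒↔)
open import Function.Properties.Inverse using (↔-trans; ↔-sym)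
open import Relation.Binary.Definitions using (DecidableEquality)
open import Relation.Binary.PropositionalEquality hiding ([_])
open import Relation.Nullary using (¬_; yes; no; contradiction)
open import Relation.Nullary.Decidable using (map′; decidable-stable)

import Algebra.Definitions.RawMonoid as RawMonoidDefinitions
import Algebra.Properties.CommutativeMonoid.Sum as CommutativeMonoidSum
import Algebra.Properties.CommutativeSemiring.Binomial as CommutativeSemiringBinomial
import Algebra.Properties.CommutativeSemiring.Exp as CommutativeSemiringExp
import Algebra.Properties.Ring as RingProperties
import Algebra.Properties.Semiring.Mult as SemiringMult
import Algebra.Properties.Semiring.Sum as SemiringSum
import Algebra.Solver.Ring.NaturalCoefficients.Default as SemiringSolver
import Data.Nat.Properties as ℕₚ

module BinomialCoefficients where
  open import Data.Nat
  open import Data.Nat.Properties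
  open import Data.Nat.Divisibility
  open import Data.Nat.DivMod using (m/n*n≡m)
  open import Data.Nat.Primality using (Prime; ¬prime[1]; euclidsLemma)
  open import Data.Nat.Combinatorics using (_C_; nCk≡n!/k![n-k]!; k![n∸k]!∣n!)
  open import Data.Sum using (inj₁; inj₂)

  prime∤! : ∀ {p} → Prime p → ∀ {m} → m < p → p ∤ m !
  prime∤! pp {zero}  _   p∣1   = ¬prime[1] (subst Prime (∣1⇒≡1 p∣1) pp)
  prime∤! pp {suc m} m<p p∣m! with euclidsLemma (suc m) (m !) pp p∣m!
  ... | inj₁ p∣1+m = <⇒≱ m<p (∣⇒≤ p∣1+m)
  ... | inj₂ p∣m!′ = prime∤! pp (<-trans (n<1+n m) m<p) p∣m!′

  nCk*k![n∸k]!≡n! : ∀ {n k} → k ≤ n → (n C k) * (k ! * (n ∸ k) !) ≡ n !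
  nCk*k![n∸k]!≡n! {n} {k} k≤n = trans (cong (_* (k ! * (n ∸ k) !)) (nCk≡n!/k![n-k]! k≤n))
                                       (m/n*n≡m {{k !* (n ∸ k) !≢0}} (k![n∸k]!∣n! k≤n))

  prime∣pCk : ∀ {p k} → Prime p → 0 < k → k < p → p ∣ p C k
  prime∣pCk {p@(suc p-1)} {k} pp 0<k k<p
    with euclidsLemma (p C k) (k ! * (p ∸ k) !) pp p∣pCk*k![p∸k]!
    where
    p∣pCk*k![p∸k]! : p ∣ (p C k) * (k ! * (p ∸ k) !)
    p∣pCk*k![p∸k]! = subst (p ∣_) (sym (nCk*k![n∸k]!≡n! (<⇒≤ k<p))) (m∣m*n (p-1 !))
  ... | inj₁ p∣pCk = p∣pCk
  ... | inj₂ p∣k![p∸k]! with euclidsLemma (k !) ((p ∸ k) !) pp p∣k![p∸k]!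
  ...   | inj₁ p∣k!     = contradiction p∣k! (prime∤! pp k<p)
  ...   | inj₂ p∣[p∸k]! = contradiction p∣[p∸k]! (prime∤! pp (∸-monoʳ-< 0<k (<⇒≤ k<p)))

open BinomialCoefficients using (prime∣pCk)

module FieldProperties (F : Field) where
  open Field F
  open ≡-Reasoning

  commutativeRing : CommutativeRing 0ℓ 0ℓ
  commutativeRing = record { isCommutativeRing = isCommutativeRing }

  open CommutativeRing commutativeRing public
    using ( +-comm; +-identityˡ; +-identityʳ; -‿inverseˡ; -‿inverseʳ; *-assoc; *-comm; distribˡ
          ; *-identityˡ; *-identityʳ; zeroˡ; zeroʳ; semiring; commutativeSemiring
          ; +-commutativeMonoid; *-commutativeMonoid )
  open RingProperties (CommutativeRing.ring commutativeRing) public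
    using ( -‿involutive; -0#≈0#; -‿distribˡ-*; x+x≈x⇒x≈0; x[y-z]≈xy-xz
          ; +-identityʳ-unique; +-inverseʳ-unique; x∙y⁻¹≈ε⇒x≈y
          ; //-rightDividesˡ; //-rightDividesʳ; -‿injective; -‿distribʳ-* )
  open RawMonoidDefinitions (CommutativeRing.+-rawMonoid commutativeRing) public
    using () renaming (_×_ to _×ₙ_)

  private
    module Exp = CommutativeSemiringExp commutativeSemiring
    open SemiringMult (CommutativeRing.semiring commutativeRing) using (×1-homo-*)
    module Product = CommutativeMonoidSum *-commutativeMonoid

  CharacteristicDivides : ℕ → Set
  CharacteristicDivides m = m ×ₙ 1# ≡ 0#

  ×1-homo-^ : ∀ m n → (m ℕ.^ n) ×ₙ 1# ≡ (m ×ₙ 1#) ^ n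
  ×1-homo-^ m zero    = +-identityʳ 1#
  ×1-homo-^ m (suc n) = trans (×1-homo-* m (m ℕ.^ n)) (cong ((m ×ₙ 1#) *_) (×1-homo-^ m n))

  1≢0 : 1# ≢ 0#
  1≢0 1≡0 = 0≢1 (sym 1≡0)

  ^≗Exp^ : ∀ x n → x ^ n ≡ x Exp.^ n
  ^≗Exp^ x zero    = refl
  ^≗Exp^ x (suc n) = cong (x *_) (^≗Exp^ x n)

  ^-homo-* : ∀ x m n → x ^ (m ℕ.+ n) ≡ x ^ m * x ^ n
  ^-homo-* x m n = begin
    x ^ (m ℕ.+ n)          ≡⟨ ^≗Exp^ x (m ℕ.+ n) ⟩
    x Exp.^ (m ℕ.+ n)      ≡⟨ Exp.^-homo-* x m n ⟩
    x Exp.^ m * x Exp.^ n  ≡⟨ cong₂ _*_ (^≗Exp^ x m) (^≗Exp^ x n) ⟨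
    x ^ m * x ^ n          ∎

  x^[m+1]≡x^m*x : ∀ x m → x ^ (m ℕ.+ 1) ≡ x ^ m * x
  x^[m+1]≡x^m*x x m = trans (^-homo-* x m 1) (cong (x ^ m *_) (*-identityʳ x))

  ^-assocʳ : ∀ x m n → (x ^ m) ^ n ≡ x ^ (m ℕ.* n)
  ^-assocʳ x m n = begin
    (x ^ m) ^ n          ≡⟨ ^≗Exp^ (x ^ m) n ⟩
    (x ^ m) Exp.^ n      ≡⟨ cong (Exp._^ n) (^≗Exp^ x m) ⟩
    (x Exp.^ m) Exp.^ n  ≡⟨ Exp.^-assocʳ x m n ⟩
    x Exp.^ (m ℕ.* n)    ≡⟨ ^≗Exp^ x (m ℕ.* n) ⟨
    x ^ (m ℕ.* n)        ∎

  ^-distrib-* : ∀ x y n → (x * y) ^ n ≡ x ^ n * y ^ n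
  ^-distrib-* x y n = begin
    (x * y) ^ n            ≡⟨ ^≗Exp^ (x * y) n ⟩
    (x * y) Exp.^ n        ≡⟨ Exp.^-distrib-* x y n ⟩
    x Exp.^ n * y Exp.^ n  ≡⟨ cong₂ _*_ (^≗Exp^ x n) (^≗Exp^ y n) ⟨
    x ^ n * y ^ n          ∎

  -x*-y≡x*y : ∀ x y → - x * - y ≡ x * y
  -x*-y≡x*y x y = begin
    - x * - y    ≡⟨ -‿distribˡ-* x (- y) ⟨
    - (x * - y)  ≡⟨ cong -_ (-‿distribʳ-* x y) ⟨
    - - (x * y)  ≡⟨ -‿involutive (x * y) ⟩
    x * y        ∎

  infix 8 _⁻¹⟨_⟩
  _⁻¹⟨_⟩ : ∀ x → x ≢ 0# → Carrier
  x ⁻¹⟨ x≢0 ⟩ = proj₁ (inverse x x≢0)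

  x*[x⁻¹*y]≡y : ∀ {x} (x≢0 : x ≢ 0#) y → x * (x ⁻¹⟨ x≢0 ⟩ * y) ≡ y
  x*[x⁻¹*y]≡y {x} x≢0 y = begin
    x * (x ⁻¹⟨ x≢0 ⟩ * y)  ≡⟨ *-assoc x _ y ⟨
    x * x ⁻¹⟨ x≢0 ⟩ * y    ≡⟨ cong (_* y) (proj₂ (inverse x x≢0)) ⟩
    1# * y                ≡⟨ *-identityˡ y ⟩
    y                     ∎

  x⁻¹*[x*y]≡y : ∀ {x} (x≢0 : x ≢ 0#) y → x ⁻¹⟨ x≢0 ⟩ * (x * y) ≡ y
  x⁻¹*[x*y]≡y {x} x≢0 y = begin
    x ⁻¹⟨ x≢0 ⟩ * (x * y)  ≡⟨ *-assoc _ x y ⟨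
    x ⁻¹⟨ x≢0 ⟩ * x * y    ≡⟨ cong (_* y) (*-comm _ x) ⟩
    x * x ⁻¹⟨ x≢0 ⟩ * y    ≡⟨ *-assoc x _ y ⟩
    x * (x ⁻¹⟨ x≢0 ⟩ * y)  ≡⟨ x*[x⁻¹*y]≡y x≢0 y ⟩
    y                     ∎

  *-scaling : ∀ {x} → x ≢ 0# → Carrier ↔ Carrier
  *-scaling {x} x≢0 = mk↔ₛ′ (x *_) (x ⁻¹⟨ x≢0 ⟩ *_) (x*[x⁻¹*y]≡y x≢0) (x⁻¹*[x*y]≡y x≢0)

  *-cancelˡ-≢0 : ∀ {x y z} → x ≢ 0# → x * y ≡ x * z → y ≡ z
  *-cancelˡ-≢0 {x} {y} {z} x≢0 xy≡xz = begin
    y                      ≡⟨ x⁻¹*[x*y]≡y x≢0 y ⟨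
    x ⁻¹⟨ x≢0 ⟩ * (x * y)  ≡⟨ cong (x ⁻¹⟨ x≢0 ⟩ *_) xy≡xz ⟩
    x ⁻¹⟨ x≢0 ⟩ * (x * z)  ≡⟨ x⁻¹*[x*y]≡y x≢0 z ⟩
    z                      ∎

  *-≢0 : ∀ {x y} → x ≢ 0# → y ≢ 0# → x * y ≢ 0#
  *-≢0 {x} x≢0 y≢0 xy≡0 = y≢0 (*-cancelˡ-≢0 x≢0 (trans xy≡0 (sym (zeroʳ x))))

  ^-≢0 : ∀ {x} n → x ≢ 0# → x ^ n ≢ 0#
  ^-≢0 zero    _   = 1≢0
  ^-≢0 (suc n) x≢0 = *-≢0 x≢0 (^-≢0 n x≢0)

  ∏ : ∀ {m} → (Fin m → Carrier) → Carrier
  ∏ = Product.sum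

  ∏-≢0 : ∀ {m} (g : Fin m → Carrier) → (∀ i → g i ≢ 0#) → ∏ g ≢ 0#
  ∏-≢0 {zero}  g _   = 1≢0
  ∏-≢0 {suc m} g g≢0 = *-≢0 (g≢0 Fin.zero) (∏-≢0 (g ∘ Fin.suc) (g≢0 ∘ Fin.suc))

  a*∏≡a^m : ∀ {m a} (g : Fin m → Carrier) i → g i ≡ 1# → (∀ j → j ≢ i → g j ≡ a) → a * ∏ g ≡ a ^ m
  a*∏≡a^m {suc m} {a} g i gi≡1 gj≡a = begin
    a * ∏ g                       ≡⟨ cong (a *_) (Product.sum-remove g) ⟩
    a * (g i * ∏ (removeAt g i))  ≡⟨ cong₂ (λ u v → a * (u * v)) gi≡1 ∏-rest ⟩
    a * (1# * a ^ m)              ≡⟨ cong (a *_) (*-identityˡ (a ^ m)) ⟩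
    a ^ suc m                     ∎
    where
    ∏-rest : ∏ (removeAt g i) ≡ a ^ m
    ∏-rest = begin
      ∏ (removeAt g i)      ≡⟨ Product.sum-cong-≗ (λ j → gj≡a (punchIn i j) (punchInᵢ≢i i j)) ⟩
      ∏ {m} (λ _ → a)       ≡⟨ Product.sum-replicate m ⟩
      a Exp.^ m             ≡⟨ ^≗Exp^ a m ⟨
      a ^ m                 ∎

module FiniteField (F : Field) {n : ℕ} (card : Fin n ⤖ Field.Carrier F) where
  open Field F
  open FieldProperties F
  open ≡-Reasoning

  enumeration : Fin n ↔ Carrier
  enumeration = ⤖⇒↔ card

  open Inverse enumeration using () renaming (to to element; from to index)

  element-index : ∀ x → element (index x) ≡ x
  element-index = Inverse.strictlyInverseˡ enumeration

  infix 4 _≟_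
  _≟_ : DecidableEquality Carrier
  x ≟ y = map′ index-injective (cong index) (index x Fin.≟ index y)
    where
    index-injective : index x ≡ index y → x ≡ y
    index-injective eq = trans (sym (element-index x)) (trans (cong element eq) (element-index y))

  module _ (M : CommutativeMonoid 0ℓ 0ℓ) where
    open CommutativeMonoid M using (_≈_) renaming (Carrier to A)
    open CommutativeMonoidSum M using (sum; sum-permute; sum-cong-≗)

    sum-reindex : (σ : Carrier ↔ Carrier) (g : Carrier → A) →
                  sum (g ∘ element) ≈ sum (g ∘ Inverse.to σ ∘ element)
    sum-reindex σ g = subst (sum (g ∘ element) ≈_)
      (sum-cong-≗ {n} (λ i → cong g (element-index _)))
      (sum-permute (g ∘ element) (↔-trans (↔-trans enumeration σ) (↔-sym enumeration)))

  private
    module Sum = CommutativeMonoidSum +-commutativeMonoid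
    module Product = CommutativeMonoidSum *-commutativeMonoid

  n×1≡0 : n ×ₙ 1# ≡ 0#
  n×1≡0 = +-identityʳ-unique (Sum.sum element) (n ×ₙ 1#) (sym (begin
    Sum.sum element                      ≡⟨ sum-reindex +-commutativeMonoid translation (λ x → x) ⟩
    Sum.sum (λ i → element i + 1#)       ≡⟨ Sum.∑-distrib-+ element (λ _ → 1#) ⟩
    Sum.sum element + Sum.sum {n} (λ _ → 1#) ≡⟨ cong (Sum.sum element +_) (Sum.sum-replicate n) ⟩
    Sum.sum element + n ×ₙ 1#            ∎))
    where
    translation : Carrier ↔ Carrier
    translation = mk↔ₛ′ (_+ 1#) (_- 1#) (//-rightDividesˡ 1#) (//-rightDividesʳ 1#)

  characteristic : ∀ {p m} → n ≡ p ℕ.^ m → CharacteristicDivides p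
  characteristic {p} {m} n≡pᵐ = decidable-stable (p ×ₙ 1# ≟ 0#) λ p×1≢0 → ^-≢0 m p×1≢0 (begin
    (p ×ₙ 1#) ^ m     ≡⟨ ×1-homo-^ p m ⟨
    (p ℕ.^ m) ×ₙ 1#   ≡⟨ cong (_×ₙ 1#) n≡pᵐ ⟨
    n ×ₙ 1#           ≡⟨ n×1≡0 ⟩
    0#                ∎)

  -- x ↦ a x permutes F, so ∏ zeroTo1 x = ∏ zeroTo1 (a x) = ∏ scaleAwayFrom0 a x · ∏ zeroTo1 x,
  -- while ∏ scaleAwayFrom0 a x = a^(n-1).
  private
    zeroTo1 : Carrier → Carrier
    zeroTo1 x with x ≟ 0#
    ... | yes _ = 1#
    ... | no  _ = x

    zeroTo1-≢0 : ∀ x → zeroTo1 x ≢ 0#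
    zeroTo1-≢0 x with x ≟ 0#
    ... | yes _   = 1≢0
    ... | no  x≢0 = x≢0

    scaleAwayFrom0 : Carrier → Carrier → Carrier
    scaleAwayFrom0 a x with x ≟ 0#
    ... | yes _ = 1#
    ... | no  _ = a

    zeroTo1-* : ∀ {a} → a ≢ 0# → ∀ x → zeroTo1 (a * x) ≡ scaleAwayFrom0 a x * zeroTo1 x
    zeroTo1-* {a} a≢0 x with x ≟ 0# | a * x ≟ 0#
    ... | yes _   | yes _    = sym (*-identityˡ 1#)
    ... | yes x≡0 | no ax≢0  = contradiction (trans (cong (a *_) x≡0) (zeroʳ a)) ax≢0
    ... | no  x≢0 | yes ax≡0 = contradiction ax≡0 (*-≢0 a≢0 x≢0)
    ... | no  _   | no _     = refl

    scaleAwayFrom0-0 : ∀ a → scaleAwayFrom0 a 0# ≡ 1#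
    scaleAwayFrom0-0 a with 0# ≟ 0#
    ... | yes _   = refl
    ... | no  0≢0 = contradiction refl 0≢0

    scaleAwayFrom0-≢0 : ∀ a {x} → x ≢ 0# → scaleAwayFrom0 a x ≡ a
    scaleAwayFrom0-≢0 a {x} x≢0 with x ≟ 0#
    ... | yes x≡0 = contradiction x≡0 x≢0
    ... | no  _   = refl

  fermat-≢0 : ∀ {a} → a ≢ 0# → a ^ n ≡ a
  fermat-≢0 {a} a≢0 = begin
    a ^ n                ≡⟨ a*∏≡a^m (v ∘ element) (index 0#) v[0]≡1 v[j]≡a ⟨
    a * ∏ (v ∘ element)  ≡⟨ cong (a *_) ∏v≡1 ⟩
    a * 1#               ≡⟨ *-identityʳ a ⟩
    a                    ∎
    where
    u v : Carrier → Carrier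
    u = zeroTo1
    v = scaleAwayFrom0 a

    v[0]≡1 : v (element (index 0#)) ≡ 1#
    v[0]≡1 = trans (cong v (element-index 0#)) (scaleAwayFrom0-0 a)

    v[j]≡a : ∀ j → j ≢ index 0# → v (element j) ≡ a
    v[j]≡a j j≢0 = scaleAwayFrom0-≢0 a λ ej≡0 →
      j≢0 (trans (sym (Inverse.strictlyInverseʳ enumeration j)) (cong index ej≡0))

    ∏u≡∏v*∏u : ∏ (u ∘ element) ≡ ∏ (v ∘ element) * ∏ (u ∘ element)
    ∏u≡∏v*∏u = begin
      ∏ (u ∘ element)                          ≡⟨ sum-reindex *-commutativeMonoid (*-scaling a≢0) u ⟩
      ∏ (u ∘ (a *_) ∘ element)                 ≡⟨ Product.sum-cong-≗ {n} (zeroTo1-* a≢0 ∘ element) ⟩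
      ∏ (λ i → v (element i) * u (element i))  ≡⟨ Product.∑-distrib-+ (v ∘ element) (u ∘ element) ⟩
      ∏ (v ∘ element) * ∏ (u ∘ element)        ∎

    ∏v≡1 : ∏ (v ∘ element) ≡ 1#
    ∏v≡1 = *-cancelˡ-≢0 (∏-≢0 (u ∘ element) (zeroTo1-≢0 ∘ element))
      (trans (*-comm _ _) (trans (sym ∏u≡∏v*∏u) (sym (*-identityʳ _))))

  fermat : ∀ x → x ^ n ≡ x
  fermat x with x ≟ 0#
  ... | no  x≢0  = fermat-≢0 x≢0
  ... | yes refl = 0^|Fin|≡0 (index 0#)
    where
    0^|Fin|≡0 : ∀ {m} → Fin m → 0# ^ m ≡ 0#
    0^|Fin|≡0 {suc m} _ = zeroˡ (0# ^ m)

module Frobenius (F : Field) {p : ℕ} (p-prime : Prime p)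
                 (char-p : FieldProperties.CharacteristicDivides F p) where
  open Field F
  open FieldProperties F
  open ≡-Reasoning
  private
    module Binomial = CommutativeSemiringBinomial commutativeSemiring
    module Exp = CommutativeSemiringExp commutativeSemiring
    open SemiringMult semiring using (×-assoc-*; ×1-homo-*)
    open SemiringSum semiring using (sum; sum-init-last; sum-cong-≗; sum-replicate-zero)

  p∣m⇒m×x≡0 : ∀ {m} x → p ∣ m → m ×ₙ x ≡ 0#
  p∣m⇒m×x≡0 {m} x (divides d refl) = begin
    m ×ₙ x                        ≡⟨ cong (m ×ₙ_) (*-identityˡ x) ⟨
    m ×ₙ (1# * x)                 ≡⟨ ×-assoc-* m 1# x ⟨
    (m ×ₙ 1#) * x                 ≡⟨ cong (_* x) (×1-homo-* d p) ⟩
    (d ×ₙ 1#) * (p ×ₙ 1#) * x     ≡⟨ cong (λ c → (d ×ₙ 1#) * c * x) char-p ⟩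
    (d ×ₙ 1#) * 0# * x            ≡⟨ cong (_* x) (zeroʳ _) ⟩
    0# * x                        ≡⟨ zeroˡ x ⟩
    0#                            ∎

  freshmans-dream : ∀ {m} → 0 < m → (∀ {k} → 0 < k → k < m → ∀ z → (m C k) ×ₙ z ≡ 0#) →
                    ∀ x y → (x + y) ^ m ≡ x ^ m + y ^ m
  freshmans-dream {suc m} _ middle≡0 x y = begin
    (x + y) ^ suc m                                 ≡⟨ ^≗Exp^ (x + y) (suc m) ⟩
    (x + y) Exp.^ suc m                             ≡⟨ Binomial.theorem (suc m) x y ⟩
    T Fin.zero + sum (T ∘ Fin.suc)                  ≡⟨ cong (T Fin.zero +_) (sum-init-last (T ∘ Fin.suc)) ⟩
    T Fin.zero + (sum (T ∘ Fin.suc ∘ inject₁) + T (Fin.suc (fromℕ m)))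
                                                    ≡⟨ cong₂ (λ a b → a + (b + T (Fin.suc (fromℕ m)))) first middle ⟩
    y ^ suc m + (0# + T (Fin.suc (fromℕ m)))        ≡⟨ cong (λ b → y ^ suc m + (0# + b)) last ⟩
    y ^ suc m + (0# + x ^ suc m)                    ≡⟨ cong (y ^ suc m +_) (+-identityˡ _) ⟩
    y ^ suc m + x ^ suc m                           ≡⟨ +-comm _ _ ⟩
    x ^ suc m + y ^ suc m                           ∎
    where
    T = Binomial.binomialTerm x y (suc m)

    first : T Fin.zero ≡ y ^ suc m
    first = trans (+-identityʳ _) (trans (*-identityˡ _) (sym (^≗Exp^ y (suc m))))

    middle : sum (T ∘ Fin.suc ∘ inject₁) ≡ 0#
    middle = trans (sum-cong-≗ {m} (λ i → middle≡0 (s≤s z≤n) (k<1+m i) _)) (sum-replicate-zero m)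
      where
      k<1+m : ∀ (i : Fin m) → suc (toℕ (inject₁ i)) < suc m
      k<1+m i = s≤s (subst (_< m) (sym (toℕ-inject₁ i)) (toℕ<n i))

    last : T (Fin.suc (fromℕ m)) ≡ x ^ suc m
    last = begin
      T (Fin.suc (fromℕ m))
        ≡⟨ cong (λ t → (suc m C suc t) ×ₙ (x Exp.^ suc t * y Exp.^ (m ∸ t))) (toℕ-fromℕ m) ⟩
      (suc m C suc m) ×ₙ (x Exp.^ suc m * y Exp.^ (m ∸ m))
        ≡⟨ cong₂ (λ c e → c ×ₙ (x Exp.^ suc m * y Exp.^ e)) (nCn≡1 (suc m)) (ℕₚ.n∸n≡0 m) ⟩
      1 ×ₙ (x Exp.^ suc m * 1#)
        ≡⟨ trans (+-identityʳ _) (trans (*-identityʳ _) (sym (^≗Exp^ x (suc m)))) ⟩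
      x ^ suc m
        ∎

  frobenius-+ᵖ : ∀ x y → (x + y) ^ p ≡ x ^ p + y ^ p
  frobenius-+ᵖ = freshmans-dream (ℕ.>-nonZero⁻¹ p {{prime⇒nonZero p-prime}})
    (λ 0<k k<p z → p∣m⇒m×x≡0 z (prime∣pCk p-prime 0<k k<p))

  frobenius-+ : ∀ j x y → (x + y) ^ (p ℕ.^ j) ≡ x ^ (p ℕ.^ j) + y ^ (p ℕ.^ j)
  frobenius-+ zero    x y = trans (*-identityʳ (x + y)) (sym (cong₂ _+_ (*-identityʳ x) (*-identityʳ y)))
  frobenius-+ (suc j) x y = begin
    (x + y) ^ (p ℕ.* p ℕ.^ j)                  ≡⟨ ^-assocʳ (x + y) p (p ℕ.^ j) ⟨
    ((x + y) ^ p) ^ (p ℕ.^ j)                  ≡⟨ cong (_^ (p ℕ.^ j)) (frobenius-+ᵖ x y) ⟩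
    (x ^ p + y ^ p) ^ (p ℕ.^ j)                ≡⟨ frobenius-+ j (x ^ p) (y ^ p) ⟩
    (x ^ p) ^ (p ℕ.^ j) + (y ^ p) ^ (p ℕ.^ j)  ≡⟨ cong₂ _+_ (^-assocʳ x p (p ℕ.^ j)) (^-assocʳ y p (p ℕ.^ j)) ⟩
    x ^ (p ℕ.* p ℕ.^ j) + y ^ (p ℕ.* p ℕ.^ j)  ∎

  frobenius-0 : ∀ j → 0# ^ (p ℕ.^ j) ≡ 0#
  frobenius-0 j = x+x≈x⇒x≈0 _ (begin
    0# ^ (p ℕ.^ j) + 0# ^ (p ℕ.^ j)  ≡⟨ frobenius-+ j 0# 0# ⟨
    (0# + 0#) ^ (p ℕ.^ j)            ≡⟨ cong (_^ (p ℕ.^ j)) (+-identityʳ 0#) ⟩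
    0# ^ (p ℕ.^ j)                   ∎)

  frobenius-‿ : ∀ j x → (- x) ^ (p ℕ.^ j) ≡ - (x ^ (p ℕ.^ j))
  frobenius-‿ j x = +-inverseʳ-unique (x ^ (p ℕ.^ j)) ((- x) ^ (p ℕ.^ j)) (begin
    x ^ (p ℕ.^ j) + (- x) ^ (p ℕ.^ j)  ≡⟨ frobenius-+ j x (- x) ⟨
    (x - x) ^ (p ℕ.^ j)                ≡⟨ cong (_^ (p ℕ.^ j)) (-‿inverseʳ x) ⟩
    0# ^ (p ℕ.^ j)                     ≡⟨ frobenius-0 j ⟩
    0#                                 ∎)

  frobenius-[x-y] : ∀ j x y → (x - y) ^ (p ℕ.^ j) ≡ x ^ (p ℕ.^ j) - y ^ (p ℕ.^ j)
  frobenius-[x-y] j x y = trans (frobenius-+ j x (- y)) (cong (x ^ (p ℕ.^ j) +_) (frobenius-‿ j y))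

module Polynomial (F : Field) where
  open Field F
  open FieldProperties F
  open ≡-Reasoning
  private
    open module Solver = SemiringSolver commutativeSemiring using (solve; _:+_; _:*_; _:=_)

  eval : List Carrier → Carrier → Carrier
  eval []       x = 0#
  eval (a ∷ as) x = a + x * eval as x

  quotient : Carrier → List Carrier → List Carrier
  quotient r []           = []
  quotient r (a ∷ [])     = []
  quotient r (a ∷ b ∷ as) = eval (b ∷ as) r ∷ quotient r (b ∷ as)

  length-quotient : ∀ r a as → length (quotient r (a ∷ as)) ≡ length as
  length-quotient r a []       = refl
  length-quotient r a (b ∷ as) = cong suc (length-quotient r b as)

  private
    a+b*0≡a : ∀ a b → a + b * 0# ≡ a
    a+b*0≡a a b = trans (cong (a +_) (zeroʳ b)) (+-identityʳ a)

  eval-quotient : ∀ r as x → eval as x ≡ (x - r) * eval (quotient r as) x + eval as r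
  eval-quotient r []       x = sym (trans (+-identityʳ _) (zeroʳ (x - r)))
  eval-quotient r (a ∷ []) x =
    trans (a+b*0≡a a x) (sym (trans (cong₂ _+_ (zeroʳ (x - r)) (a+b*0≡a a r)) (+-identityˡ a)))
  eval-quotient r (a ∷ b ∷ as) x = begin
    a + x * eval (b ∷ as) x
      ≡⟨ cong (λ e → a + x * e) (eval-quotient r (b ∷ as) x) ⟩
    a + x * ((x - r) * q[x] + e[r])
      ≡⟨ cong (λ y → a + y * ((x - r) * q[x] + e[r])) (//-rightDividesˡ r x) ⟨
    a + (x - r + r) * ((x - r) * q[x] + e[r])
      ≡⟨ division a (x - r) r q[x] e[r] ⟩
    (x - r) * (e[r] + (x - r + r) * q[x]) + (a + r * e[r])
      ≡⟨ cong (λ y → (x - r) * (e[r] + y * q[x]) + (a + r * e[r])) (//-rightDividesˡ r x) ⟩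
    (x - r) * (e[r] + x * q[x]) + (a + r * e[r])
      ∎
    where
    q[x] = eval (quotient r (b ∷ as)) x
    e[r] = eval (b ∷ as) r
    -- with d = x - r this is a commutative-semiring identity
    division : ∀ a d r q e → a + (d + r) * (d * q + e) ≡ d * (e + (d + r) * q) + (a + r * e)
    division = solve 5 (λ a d r q e →
      (a :+ (d :+ r) :* (d :* q :+ e)) := (d :* (e :+ (d :+ r) :* q) :+ (a :+ r :* e))) refl

  quotient≡0∧root⇒≡0 : ∀ r as → All (_≡ 0#) (quotient r as) → eval as r ≡ 0# → All (_≡ 0#) as
  quotient≡0∧root⇒≡0 r []           _          _      = []
  quotient≡0∧root⇒≡0 r (a ∷ [])     _          a≡0    = trans (sym (a+b*0≡a a r)) a≡0 ∷ []
  quotient≡0∧root⇒≡0 r (a ∷ b ∷ as) (e≡0 ∷ q≡0) a+re≡0 =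
    trans (sym (a+b*0≡a a r)) (trans (cong (λ e → a + r * e) (sym e≡0)) a+re≡0)
    ∷ quotient≡0∧root⇒≡0 r (b ∷ as) q≡0 e≡0

  vanishing⇒zero : ∀ {m} (points : Fin m → Carrier) → Injective _≡_ _≡_ points →
                   ∀ as → length as ≤ m → (∀ i → eval as (points i) ≡ 0#) → All (_≡ 0#) as
  vanishing⇒zero         points injective []       _             _      = []
  vanishing⇒zero {suc m} points injective (a ∷ as) (s≤s |as|≤m) vanish =
    quotient≡0∧root⇒≡0 r (a ∷ as)
      (vanishing⇒zero (points ∘ Fin.suc) (suc-injective ∘ injective) (quotient r (a ∷ as))
         (subst (_≤ m) (sym (length-quotient r a as)) |as|≤m) quotient-vanishes)
      (vanish Fin.zero)
    where
    r = points Fin.zero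

    quotient-vanishes : ∀ i → eval (quotient r (a ∷ as)) (points (Fin.suc i)) ≡ 0#
    quotient-vanishes i = *-cancelˡ-≢0 x-r≢0 (begin
      (x - r) * q[x]                    ≡⟨ +-identityʳ _ ⟨
      (x - r) * q[x] + 0#               ≡⟨ cong ((x - r) * q[x] +_) (vanish Fin.zero) ⟨
      (x - r) * q[x] + eval (a ∷ as) r  ≡⟨ eval-quotient r (a ∷ as) x ⟨
      eval (a ∷ as) x                   ≡⟨ vanish (Fin.suc i) ⟩
      0#                                ≡⟨ zeroʳ (x - r) ⟨
      (x - r) * 0#                      ∎)
      where
      x = points (Fin.suc i)
      q[x] = eval (quotient r (a ∷ as)) x
      x-r≢0 : x - r ≢ 0#
      x-r≢0 x-r≡0 with injective (x∙y⁻¹≈ε⇒x≈y x r x-r≡0)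
      ... | ()

  binomial : ℕ → Carrier → Carrier → List Carrier
  binomial j α β = 0# ∷ β ∷ replicate j 0# ++ [ α ]

  length-binomial : ∀ j α β → length (binomial j α β) ≡ 3 ℕ.+ j
  length-binomial j α β = cong (2 ℕ.+_)
    (trans (length-++ (replicate j 0#)) (trans (cong (ℕ._+ 1) (length-replicate j)) (ℕₚ.+-comm j 1)))

  eval-replicate-0 : ∀ j as x → eval (replicate j 0# ++ as) x ≡ x ^ j * eval as x
  eval-replicate-0 zero    as x = sym (*-identityˡ _)
  eval-replicate-0 (suc j) as x = begin
    0# + x * eval (replicate j 0# ++ as) x  ≡⟨ +-identityˡ _ ⟩
    x * eval (replicate j 0# ++ as) x       ≡⟨ cong (x *_) (eval-replicate-0 j as x) ⟩
    x * (x ^ j * eval as x)                 ≡⟨ *-assoc x _ _ ⟨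
    x ^ suc j * eval as x                   ∎

  eval-binomial : ∀ j α β x → eval (binomial j α β) x ≡ α * x ^ (2 ℕ.+ j) + β * x
  eval-binomial j α β x = begin
    0# + x * (β + x * eval (replicate j 0# ++ [ α ]) x)  ≡⟨ +-identityˡ _ ⟩
    x * (β + x * eval (replicate j 0# ++ [ α ]) x)       ≡⟨ cong (λ e → x * (β + x * e)) (eval-replicate-0 j [ α ] x) ⟩
    x * (β + x * (x ^ j * (α + x * 0#)))                 ≡⟨ cong (λ e → x * (β + x * (x ^ j * e))) (a+b*0≡a α x) ⟩
    x * (β + x * (x ^ j * α))                            ≡⟨ expand α β x (x ^ j) ⟩
    α * (x * (x * x ^ j)) + β * x                        ∎
    where
    expand : ∀ α β x y → x * (β + x * (y * α)) ≡ α * (x * (x * y)) + β * x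
    expand = solve 4 (λ α β x y → (x :* (β :+ x :* (y :* α))) := (α :* (x :* (x :* y)) :+ β :* x)) refl

  binomial-not-vanishing : ∀ {m d α} β (points : Fin m → Carrier) → Injective _≡_ _≡_ points →
                           2 ≤ d → d < m → α ≢ 0# → ¬ (∀ w → α * w ^ d + β * w ≡ 0#)
  binomial-not-vanishing {m} {suc (suc j)} {α} β points injective (s≤s (s≤s _)) d<m α≢0 vanish
    with vanishing⇒zero points injective (binomial j α β)
           (subst (_≤ m) (sym (length-binomial j α β)) d<m)
           (λ i → trans (eval-binomial j α β (points i)) (vanish (points i)))
  ... | _ ∷ _ ∷ zeros with ++⁻ʳ (replicate j 0#) zeros
  ...   | α≡0 ∷ [] = α≢0 α≡0

module PlanarityConstraints (F : Field) {p : ℕ} (p-prime : Prime p) {k : ℕ} (1≤k : 1 ≤ k) (l : ℕ)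
                            (card : HasCard F (p ℕ.^ k ℕ.* p ℕ.^ k)) where
  open Field F
  open FieldProperties F
  open FiniteField F card using (_≟_; characteristic; fermat)
  open Polynomial F using (binomial-not-vanishing)
  open Setup F (p ℕ.^ k) (p ℕ.^ l)
  open Bijection card using (injective) renaming (to to element)
  open ≡-Reasoning
  private
    open module Solver = SemiringSolver commutativeSemiring using (solve; _:+_; _:*_; _:=_)

    q Q : ℕ
    q = p ℕ.^ k
    Q = p ℕ.^ l

  open Frobenius F p-prime (characteristic {p} {k ℕ.+ k} (sym (ℕₚ.^-distribˡ-+-* p k k)))

  2≤q : 2 ≤ q
  2≤q = ℕₚ.≤-trans (ℕ.nonTrivial⇒n>1 p {{prime⇒nonTrivial p-prime}})
          (ℕₚ.≤-trans (ℕₚ.≤-reflexive (sym (ℕₚ.*-identityʳ p))) (ℕₚ.^-monoʳ-≤ p {{prime⇒nonZero p-prime}} 1≤k))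

  q<q*q : q < q ℕ.* q
  q<q*q = ℕₚ.m<m*n q q {{ℕₚ.m^n≢0 p k {{prime⇒nonZero p-prime}}}} 2≤q

  conj-+ : ∀ x y → conj (x + y) ≡ conj x + conj y
  conj-+ = frobenius-+ k

  conj-* : ∀ x y → conj (x * y) ≡ conj x * conj y
  conj-* x y = ^-distrib-* x y q

  conj-involutive : ∀ x → conj (conj x) ≡ x
  conj-involutive x = trans (^-assocʳ x q q) (fermat x)

  conj-^ : ∀ x m → conj (x ^ m) ≡ conj x ^ m
  conj-^ x m = trans (^-assocʳ x m q) (trans (cong (x ^_) (ℕₚ.*-comm m q)) (sym (^-assocʳ x q m)))

  bilinear : Coeffs → Carrier → Carrier → Carrier → Carrier → Carrier
  bilinear c u₁ u₂ v₁ v₂ = c0 c * (u₁ * v₁) + c1 c * (u₁ * v₂) + c2 c * (u₂ * v₁) + c3 c * (u₂ * v₂)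

  f≡bilinear : ∀ c x → f c x ≡ bilinear c (conj (x ^ Q)) (x ^ Q) (conj x) x
  f≡bilinear c x = cong₂ _+_ (cong₂ _+_ (cong₂ _+_ (cong (c0 c *_) x^[qQ+q])
                                                    (cong (c1 c *_) x^[qQ+1]))
                                         (cong (c2 c *_) (^-homo-* x Q q)))
                              (cong (c3 c *_) (x^[m+1]≡x^m*x x Q))
    where
    x^[qQ] : x ^ (q ℕ.* Q) ≡ conj (x ^ Q)
    x^[qQ] = trans (cong (x ^_) (ℕₚ.*-comm q Q)) (sym (^-assocʳ x Q q))
    x^[qQ+q] : x ^ (q ℕ.* Q ℕ.+ q) ≡ conj (x ^ Q) * conj x
    x^[qQ+q] = trans (^-homo-* x (q ℕ.* Q) q) (cong (_* conj x) x^[qQ])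
    x^[qQ+1] : x ^ (q ℕ.* Q ℕ.+ 1) ≡ conj (x ^ Q) * x
    x^[qQ+1] = trans (x^[m+1]≡x^m*x x (q ℕ.* Q)) (cong (_* x) x^[qQ])

  bilinear-‿ : ∀ c u₁ u₂ v₁ v₂ → bilinear c (- u₁) (- u₂) (- v₁) (- v₂) ≡ bilinear c u₁ u₂ v₁ v₂
  bilinear-‿ c u₁ u₂ v₁ v₂ = cong₂ _+_ (cong₂ _+_ (cong₂ _+_ (term (c0 c) u₁ v₁) (term (c1 c) u₁ v₂))
                                                  (term (c2 c) u₂ v₁))
                                       (term (c3 c) u₂ v₂)
    where
    term : ∀ a u v → a * (- u * - v) ≡ a * (u * v)
    term a u v = cong (a *_) (-x*-y≡x*y u v)

  bilinear-0 : ∀ c → bilinear c 0# 0# 0# 0# ≡ 0#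
  bilinear-0 c = trans (cong₂ _+_ (cong₂ _+_ (cong₂ _+_ (term (c0 c)) (term (c1 c))) (term (c2 c))) (term (c3 c)))
                       (trans (+-identityʳ _) (trans (+-identityʳ _) (+-identityʳ 0#)))
    where
    term : ∀ a → a * (0# * 0#) ≡ 0#
    term a = trans (cong (a *_) (zeroʳ 0#)) (zeroʳ a)

  bilinear-swap : ∀ a b c d u₁ u₂ v₁ v₂ →
    bilinear ⟨ a , b , c , d ⟩ u₁ u₂ v₁ v₂ ≡ bilinear ⟨ d , c , b , a ⟩ u₂ u₁ v₂ v₁
  bilinear-swap = solve 8 (λ a b c d u₁ u₂ v₁ v₂ →
    (a :* (u₁ :* v₁) :+ b :* (u₁ :* v₂) :+ c :* (u₂ :* v₁) :+ d :* (u₂ :* v₂)) :=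
    (d :* (u₂ :* v₂) :+ c :* (u₂ :* v₁) :+ b :* (u₁ :* v₂) :+ a :* (u₁ :* v₁))) refl

  conj-bilinear : ∀ c u₁ u₂ v₁ v₂ → conj (bilinear c u₁ u₂ v₁ v₂) ≡
    bilinear ⟨ conj (c0 c) , conj (c1 c) , conj (c2 c) , conj (c3 c) ⟩ (conj u₁) (conj u₂) (conj v₁) (conj v₂)
  conj-bilinear c u₁ u₂ v₁ v₂ = begin
    conj (t₀ + t₁ + t₂ + t₃)                ≡⟨ conj-+ (t₀ + t₁ + t₂) t₃ ⟩
    conj (t₀ + t₁ + t₂) + conj t₃           ≡⟨ cong (_+ conj t₃) (conj-+ (t₀ + t₁) t₂) ⟩
    conj (t₀ + t₁) + conj t₂ + conj t₃      ≡⟨ cong (λ s → s + conj t₂ + conj t₃) (conj-+ t₀ t₁) ⟩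
    conj t₀ + conj t₁ + conj t₂ + conj t₃   ≡⟨ cong₂ _+_ (cong₂ _+_ (cong₂ _+_ (term (c0 c) u₁ v₁) (term (c1 c) u₁ v₂))
                                                                (term (c2 c) u₂ v₁))
                                                     (term (c3 c) u₂ v₂) ⟩
    bilinear ⟨ conj (c0 c) , conj (c1 c) , conj (c2 c) , conj (c3 c) ⟩ (conj u₁) (conj u₂) (conj v₁) (conj v₂) ∎
    where
    t₀ = c0 c * (u₁ * v₁)
    t₁ = c1 c * (u₁ * v₂)
    t₂ = c2 c * (u₂ * v₁)
    t₃ = c3 c * (u₂ * v₂)
    term : ∀ a u v → conj (a * (u * v)) ≡ conj a * (conj u * conj v)
    term a u v = trans (conj-* a (u * v)) (cong (conj a *_) (conj-* u v))

  f-even : ∀ c x → f c (- x) ≡ f c x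
  f-even c x = begin
    f c (- x)
      ≡⟨ f≡bilinear c (- x) ⟩
    bilinear c (conj ((- x) ^ Q)) ((- x) ^ Q) (conj (- x)) (- x)
      ≡⟨ cong₂ (λ u v → bilinear c (conj u) u v (- x)) (frobenius-‿ l x) (frobenius-‿ k x) ⟩
    bilinear c (conj (- X)) (- X) (- conj x) (- x)
      ≡⟨ cong (λ u → bilinear c u (- X) (- conj x) (- x)) (frobenius-‿ k X) ⟩
    bilinear c (- conj X) (- X) (- conj x) (- x)
      ≡⟨ bilinear-‿ c (conj X) X (conj x) x ⟩
    bilinear c (conj X) X (conj x) x
      ≡⟨ f≡bilinear c x ⟨
    f c x
      ∎
    where
    X = x ^ Q

  f-zero : ∀ c → f c 0# ≡ 0#
  f-zero c = begin
    f c 0#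
      ≡⟨ f≡bilinear c 0# ⟩
    bilinear c (conj (0# ^ Q)) (0# ^ Q) (conj 0#) 0#
      ≡⟨ cong (λ u → bilinear c (conj u) u (conj 0#) 0#) (frobenius-0 l) ⟩
    bilinear c (conj 0#) 0# (conj 0#) 0#
      ≡⟨ cong (λ u → bilinear c u 0# u 0#) (frobenius-0 k) ⟩
    bilinear c 0# 0# 0# 0#
      ≡⟨ bilinear-0 c ⟩
    0#
      ∎

  f-conj : ∀ c x → conj (f c x) ≡ f (Bcoeffs c) x
  f-conj c x = begin
    conj (f c x)
      ≡⟨ cong conj (f≡bilinear c x) ⟩
    conj (bilinear c (conj X) X (conj x) x)
      ≡⟨ conj-bilinear c (conj X) X (conj x) x ⟩
    bilinear c̄ (conj (conj X)) (conj X) (conj (conj x)) (conj x)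
      ≡⟨ cong₂ (λ u v → bilinear c̄ u (conj X) v (conj x)) (conj-involutive X) (conj-involutive x) ⟩
    bilinear c̄ X (conj X) x (conj x)
      ≡⟨ bilinear-swap (conj (c0 c)) (conj (c1 c)) (conj (c2 c)) (conj (c3 c)) X (conj X) x (conj x) ⟩
    bilinear (Bcoeffs c) (conj X) X (conj x) x
      ≡⟨ f≡bilinear (Bcoeffs c) x ⟨
    f (Bcoeffs c) x
      ∎
    where
    X = x ^ Q
    c̄ = ⟨ conj (c0 c) , conj (c1 c) , conj (c2 c) , conj (c3 c) ⟩

  f-factor : ∀ c {z x} → conj x ≡ z * x → f c x ≡ (x ^ Q * x) * A c z
  f-factor c {z} {x} x̄≡zx = begin
    f c x
      ≡⟨ f≡bilinear c x ⟩
    bilinear c (conj X) X (conj x) x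
      ≡⟨ cong₂ (λ u v → bilinear c u X v x) X̄≡zᵠX x̄≡zx ⟩
    bilinear c (z ^ Q * X) X (z * x) x
      ≡⟨ factor (c0 c) (c1 c) (c2 c) (c3 c) (z ^ Q) z X x ⟩
    (X * x) * (c0 c * (z ^ Q * z) + c1 c * z ^ Q + c2 c * z + c3 c)
      ≡⟨ cong (λ w → (X * x) * (c0 c * w + c1 c * z ^ Q + c2 c * z + c3 c)) (x^[m+1]≡x^m*x z Q) ⟨
    (X * x) * A c z
      ∎
    where
    X = x ^ Q
    X̄≡zᵠX : conj X ≡ z ^ Q * X
    X̄≡zᵠX = trans (conj-^ x Q) (trans (cong (_^ Q) x̄≡zx) (^-distrib-* z x Q))
    factor : ∀ c₀ c₁ c₂ c₃ Z z X x →
      c₀ * ((Z * X) * (z * x)) + c₁ * ((Z * X) * x) + c₂ * (X * (z * x)) + c₃ * (X * x) ≡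
      (X * x) * (c₀ * (Z * z) + c₁ * Z + c₂ * z + c₃)
    factor = solve 8 (λ c₀ c₁ c₂ c₃ Z z X x →
      (c₀ :* ((Z :* X) :* (z :* x)) :+ c₁ :* ((Z :* X) :* x) :+ c₂ :* (X :* (z :* x)) :+ c₃ :* (X :* x)) :=
      ((X :* x) :* (c₀ :* (Z :* z) :+ c₁ :* Z :+ c₂ :* z :+ c₃))) refl

  f-scale : ∀ s a b c d x → f ⟨ s * a , s * b , s * c , s * d ⟩ x ≡ s * f ⟨ a , b , c , d ⟩ x
  f-scale s a b c d x = linear s a b c d (x ^ (q ℕ.* Q ℕ.+ q)) (x ^ (q ℕ.* Q ℕ.+ 1)) (x ^ (Q ℕ.+ q)) (x ^ (Q ℕ.+ 1))
    where
    linear : ∀ s a b c d y₀ y₁ y₂ y₃ →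
      s * a * y₀ + s * b * y₁ + s * c * y₂ + s * d * y₃ ≡ s * (a * y₀ + b * y₁ + c * y₂ + d * y₃)
    linear = solve 9 (λ s a b c d y₀ y₁ y₂ y₃ →
      (s :* a :* y₀ :+ s :* b :* y₁ :+ s :* c :* y₂ :+ s :* d :* y₃) :=
      (s :* (a :* y₀ :+ b :* y₁ :+ c :* y₂ :+ d :* y₃))) refl

  conj-f-scalar : ∀ c (g : GConstant c) x → conj (f c x) ≡ proj₁ g * f c x
  conj-f-scalar c (s , b₀ , b₁ , b₂ , b₃) x = begin
    conj (f c x)                                          ≡⟨ f-conj c x ⟩
    f (Bcoeffs c) x                                       ≡⟨ cong (λ d → f d x) (coeffs-cong b₀ b₁ b₂ b₃) ⟩
    f ⟨ s * c0 c , s * c1 c , s * c2 c , s * c3 c ⟩ x     ≡⟨ f-scale s (c0 c) (c1 c) (c2 c) (c3 c) x ⟩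
    s * f c x                                             ∎
    where
    coeffs-cong : ∀ {a b c d a′ b′ c′ d′} → a ≡ a′ → b ≡ b′ → c ≡ c′ → d ≡ d′ →
                  ⟨ a , b , c , d ⟩ ≡ ⟨ a′ , b′ , c′ , d′ ⟩
    coeffs-cong refl refl refl refl = refl

  even-planar⇒≢0⇒≢h0 : ∀ {h} → Planar h → (∀ x → h (- x) ≡ h x) → ∀ {x} → x ≢ 0# → h x ≢ h 0#
  even-planar⇒≢0⇒≢h0 {h} planar even {x} x≢0 hx≡h0 =
    x≢0 (-‿injective (trans (proj₁ (planar x x≢0) Δ[-x]≡Δ[0]) (sym -0#≈0#)))
    where
    Δ[-x]≡Δ[0] : h (- x + x) - h (- x) ≡ h (0# + x) - h 0#
    Δ[-x]≡Δ[0] = begin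
      h (- x + x) - h (- x)  ≡⟨ cong₂ (λ u v → h u - v) (-‿inverseˡ x) (even x) ⟩
      h 0# - h x             ≡⟨ cong₂ _-_ (sym hx≡h0) hx≡h0 ⟩
      h x - h 0#             ≡⟨ cong (λ u → h u - h 0#) (+-identityˡ x) ⟨
      h (0# + x) - h 0#      ∎

  planar⇒¬GConstant : ∀ c → Planar (f c) → ¬ GConstant c
  planar⇒¬GConstant c planar g =
    binomial-not-vanishing (- s) element injective 2≤q q<q*q 1≢0 conj-w-linear
    where
    s = proj₁ g

    Δ : Carrier → Carrier
    Δ y = f c (y + 1#) - f c y

    conj-Δ : ∀ y → conj (Δ y) ≡ s * Δ y
    conj-Δ y = begin
      conj (f c (y + 1#) - f c y)              ≡⟨ frobenius-[x-y] k (f c (y + 1#)) (f c y) ⟩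
      conj (f c (y + 1#)) - conj (f c y)       ≡⟨ cong₂ _-_ (conj-f-scalar c g (y + 1#)) (conj-f-scalar c g y) ⟩
      s * f c (y + 1#) - s * f c y             ≡⟨ x[y-z]≈xy-xz s (f c (y + 1#)) (f c y) ⟨
      s * Δ y                                  ∎

    conj-w-linear : ∀ w → 1# * conj w + (- s) * w ≡ 0#
    conj-w-linear w with proj₂ (planar 1# 1≢0) w
    ... | y , Δy≡w = begin
      1# * conj w + (- s) * w   ≡⟨ cong₂ _+_ (*-identityˡ (conj w)) (sym (-‿distribˡ-* s w)) ⟩
      conj w - s * w            ≡⟨ cong (λ u → conj u - s * w) (Δy≡w refl) ⟨
      conj (Δ y) - s * w        ≡⟨ cong (_- s * w) (trans (conj-Δ y) (cong (s *_) (Δy≡w refl))) ⟩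
      s * w - s * w             ≡⟨ -‿inverseʳ (s * w) ⟩
      0#                        ∎

  planar⇒f≢0 : ∀ c → Planar (f c) → ∀ {x} → x ≢ 0# → f c x ≢ 0#
  planar⇒f≢0 c planar x≢0 fx≡0 = even-planar⇒≢0⇒≢h0 planar (f-even c) x≢0 (trans fx≡0 (sym (f-zero c)))

  μ-eigenvector : ∀ {z} → z * conj z ≡ 1# → ∀ w →
                  conj (conj z * conj w + 1# * w) ≡ z * (conj z * conj w + 1# * w)
  μ-eigenvector {z} zz̄≡1 w = begin
    conj (conj z * conj w + 1# * w)         ≡⟨ conj-+ (conj z * conj w) (1# * w) ⟩
    conj (conj z * conj w) + conj (1# * w)  ≡⟨ cong₂ _+_ (conj-* (conj z) (conj w)) (cong conj (*-identityˡ w)) ⟩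
    conj (conj z) * conj (conj w) + conj w  ≡⟨ cong (_+ conj w) (cong₂ _*_ (conj-involutive z) (conj-involutive w)) ⟩
    z * w + conj w                          ≡⟨ +-comm (z * w) (conj w) ⟩
    conj w + z * w                          ≡⟨ cong₂ _+_ zz̄w̄≡w̄ (cong (z *_) (*-identityˡ w)) ⟨
    z * (conj z * conj w) + z * (1# * w)    ≡⟨ distribˡ z (conj z * conj w) (1# * w) ⟨
    z * (conj z * conj w + 1# * w)          ∎
    where
    zz̄w̄≡w̄ : z * (conj z * conj w) ≡ conj w
    zz̄w̄≡w̄ = trans (sym (*-assoc z (conj z) (conj w))) (trans (cong (_* conj w) zz̄≡1) (*-identityˡ (conj w)))

  planar⇒A≢0-on-μ : ∀ c → Planar (f c) → ∀ z → InMu z → A c z ≢ 0#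
  planar⇒A≢0-on-μ c planar z z∈μ Az≡0 =
    binomial-not-vanishing 1# element injective 2≤q q<q*q z̄≢0 vanish
    where
    zz̄≡1 : z * conj z ≡ 1#
    zz̄≡1 = trans (cong (z ^_) (ℕₚ.+-comm 1 q)) z∈μ

    z̄≢0 : conj z ≢ 0#
    z̄≢0 z̄≡0 = 0≢1 (trans (sym (zeroʳ z)) (trans (cong (z *_) (sym z̄≡0)) zz̄≡1))

    vanish : ∀ w → conj z * conj w + 1# * w ≡ 0#
    vanish w = decidable-stable (x ≟ 0#) λ x≢0 → planar⇒f≢0 c planar x≢0 (begin
      f c x                ≡⟨ f-factor c (μ-eigenvector zz̄≡1 w) ⟩
      (x ^ Q * x) * A c z  ≡⟨ cong ((x ^ Q * x) *_) Az≡0 ⟩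
      (x ^ Q * x) * 0#     ≡⟨ zeroʳ (x ^ Q * x) ⟩
      0#                   ∎)
      where
      x = conj z * conj w + 1# * w

open import Data.Nat using (_^_; _*_; _%_)

lemma6p3 : (p k l : ℕ) → Prime p → p % 2 ≡ 1 → 1 ≤ k → 1 ≤ l →
    (F : Field) → HasCard F ((p ^ k) * (p ^ k)) →
    let open Setup F (p ^ k) (p ^ l)
    in (c : Coeffs) → NonZero c → Planar (f c) →
       ¬ GConstant c × (∀ x → InMu x → ¬ (A c x ≡ Field.0# F))
lemma6p3 p k l p-prime _ 1≤k _ F card c _ planar =
  planar⇒¬GConstant c planar , planar⇒A≢0-on-μ c planar
  where open PlanarityConstraints F p-prime 1≤k l card
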